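{- Let $n\ge1$. In the combinatorial barcode lattice $\mathbf{BL}(2^n)$, whose elements are identified with perfect matchings of $[2n]$ (positions $p<p'$ are matched iff they carry the same label), the permutational matchings (those avoiding the pattern $1122$) are exactly the elements of the interval $[\,12\cdots n12\cdots n,\ 12\cdots nn\cdots21\,]$.
   Context: $\mathbf{BL}(2^n)$ is the set of words containing each of $1,\dots,n$ exactly twice in which the first occurrence of $i$ precedes the first occurrence of $i+1$ for each $i\in[n-1]$, partially ordered by the reflexive-transitive closure of: $s\lessdot t$ iff $t$ arises from $s$ by swapping two adjacent entries $a<b$ appearing as $ab$ in $s$. A word contains the pattern $1122$ if it has a subsequence of the form $aabb$ with $a\ne b$ (i.e. both occurrences of some label precede both occurrences of another label); otherwise it avoids it. -}

module Defs where

open import Data.Nat using (ℕ; zero; suc; _+_; _*_; _≤_; _<_)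
open import Data.Nat.Properties using (_≟_)
open import Data.List using (List; []; _∷_; _++_; applyUpTo; reverse; length)
open import Data.List.Relation.Binary.Sublist.Propositional using (_⊆_)
open import Data.Product using (Σ; ∃; ∃-syntax; _×_; _,_)
open import Relation.Binary.PropositionalEquality using (_≡_; _≢_)
open import Relation.Binary.Construct.Closure.ReflexiveTransitive using (Star)
open import Relation.Nullary using (yes; no)
open import Data.Sum using (_⊎_)

Word : Set
Word = List ℕ

count : ℕ → Word → ℕ
count x [] = 0
count x (y ∷ w) with x ≟ y
... | yes _ = suc (count x w)
... | no  _ = count x w

-- 0-based position of the first occurrence of x in w (length w if absent)
firstIndex : ℕ → Word → ℕ
firstIndex x [] = 0
firstIndex x (y ∷ w) with x ≟ y
... | yes _ = 0
... | no  _ = suc (firstIndex x w)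

IsBL : ℕ → Word → Set
IsBL n w =
  (∀ x → 1 ≤ x → x ≤ n → count x w ≡ 2) ×
  (∀ x → count x w ≡ 0 ⊎ (1 ≤ x × x ≤ n)) ×
  (∀ i → 1 ≤ i → suc i ≤ n → firstIndex i w < firstIndex (suc i) w)

data Cover (n : ℕ) : Word → Word → Set where
  swap : ∀ u v a b → a < b →
         IsBL n (u ++ a ∷ b ∷ v) → IsBL n (u ++ b ∷ a ∷ v) →
         Cover n (u ++ a ∷ b ∷ v) (u ++ b ∷ a ∷ v)

_≤BL[_]_ : Word → ℕ → Word → Set
s ≤BL[ n ] t = Star (Cover n) s t

Contains1122 : Word → Set
Contains1122 w = ∃[ a ] ∃[ b ] (a ≢ b × (a ∷ a ∷ b ∷ b ∷ []) ⊆ w)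

ascending : ℕ → Word
ascending n = applyUpTo suc n

bottomBL : ℕ → Word
bottomBL n = ascending n ++ ascending n

topBL : ℕ → Word
topBL n = ascending n ++ reverse (ascending n)

-- A 1122-avoiding word of BL(2^n) starts with 1 2 ⋯ n: if the prefix 1 ⋯ k were followed by
-- some x ≠ k+1, then either x ≤ k and x x n n is a subword, or x > k+1 and x occurs before the
-- first k+1. Hence the 1122-avoiding words are exactly the words 1 2 ⋯ n τ with τ a permutation
-- of 1 ⋯ n; each of these avoids 1122 because every label occurs once on either side.
-- Insertion sort turns τ into a chain of ascending adjacent swaps from 1 ⋯ n to τ, and (sorting
-- by ≥) into one from τ to n ⋯ 1; behind the prefix these swaps are covers, giving both bounds.
-- Conversely a cover can never move a label in front of the first occurrence of a smaller one,
-- so every word above the bottom element keeps the prefix 1 2 ⋯ n.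

module Submission where

open import Defs
open import Data.Nat using (ℕ; zero; suc; _+_; _≤_; _<_; z≤n; s≤s; _≤?_)
open import Data.Nat.Properties
open import Data.List using (List; []; _∷_; _++_; [_]; length; replicate; reverse)
open import Data.List.Properties
  using (++-assoc; ++-identityʳ; ∷-injective; applyUpTo-∷ʳ; length-applyUpTo; reverse-applyUpTo)
open import Data.List.Relation.Binary.Permutation.Propositional as ↭
  using (_↭_; ↭-sym; ↭⇒↭ₛ; module PermutationReasoning)
open import Data.List.Relation.Binary.Permutation.Propositional.Properties using (shift; ↭-reverse)
open import Data.List.Relation.Binary.Sublist.Propositional using (_⊆_; []; _∷_; _∷ʳ_; minimum)
open import Data.List.Relation.Binary.Sublist.Propositional.Properties using (∷ˡ⁻) renaming (++⁺ to ⊆-++⁺)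
open import Data.Product using (_×_; _,_; proj₁; proj₂; ∃; ∃₂)
open import Data.Sum using (_⊎_; inj₁; inj₂)
open import Level using (_⊔_)
open import Function using (flip; id; _∘_)
open import Function.Bundles using (_⇔_; mk⇔)
open import Relation.Binary.Core using (Rel; _⇒_)
open import Relation.Binary.Definitions using (tri<; tri≈; tri>)
open import Relation.Binary.Bundles using (DecTotalOrder)
open import Relation.Binary.Construct.Closure.ReflexiveTransitive as Star using (Star; ε; _◅_; _◅◅_; gmap)
import Data.List.Sort.InsertionSort.Base as InsertionSort
import Data.List.Sort.InsertionSort.Properties as InsertionSortₚ
open import Data.List.Relation.Unary.Sorted.TotalOrder using (Sorted)
open import Data.List.Relation.Unary.Sorted.TotalOrder.Properties
  using (↗↭↗⇒≋; applyUpTo⁺₂; applyDownFrom⁺₂)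
open import Data.List.Relation.Binary.Equality.Propositional using (≋⇒≡)
open import Relation.Binary.Properties.DecTotalOrder ≤-decTotalOrder using (≥-decTotalOrder; ≥-totalOrder)
open import Relation.Nullary using (¬_; yes; no; contradiction)
open import Relation.Nullary.Decidable using (_×-dec_)
open import Relation.Binary.PropositionalEquality
  using (_≡_; _≢_; refl; sym; trans; cong; cong₂; subst; subst₂; module ≡-Reasoning)

count-here : ∀ x s → count x (x ∷ s) ≡ suc (count x s)
count-here x s with x ≟ x
... | yes _ = refl
... | no x≢x = contradiction refl x≢x

count-there : ∀ {x y} s → x ≢ y → count x (y ∷ s) ≡ count x s
count-there {x} {y} s x≢y with x ≟ y
... | yes x≡y = contradiction x≡y x≢y
... | no _ = refl

count-++ : ∀ x s t → count x (s ++ t) ≡ count x s + count x t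
count-++ x [] t = refl
count-++ x (y ∷ s) t with x ≟ y
... | yes _ = cong suc (count-++ x s t)
... | no _ = count-++ x s t

count-∷ : ∀ x y s → count x (y ∷ s) ≡ count x [ y ] + count x s
count-∷ x y s = count-++ x [ y ] s

count-middle≢0 : ∀ x u r → count x (u ++ x ∷ r) ≢ 0
count-middle≢0 x u r c≡0 = 1+n≢0 (begin
  suc (count x u + count x r) ≡⟨ +-suc (count x u) (count x r) ⟨
  count x u + suc (count x r) ≡⟨ cong (count x u +_) (count-here x r) ⟨
  count x u + count x (x ∷ r) ≡⟨ count-++ x u (x ∷ r) ⟨
  count x (u ++ x ∷ r)        ≡⟨ c≡0 ⟩
  0                           ∎)
  where open ≡-Reasoning

count≤1⇒count-prefix≡0 : ∀ x u r → count x (u ++ x ∷ r) ≤ 1 → count x u ≡ 0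
count≤1⇒count-prefix≡0 x u r once = n≤0⇒n≡0 (≤-pred (begin
  suc (count x u)              ≤⟨ s≤s (m≤m+n (count x u) (count x r)) ⟩
  suc (count x u + count x r)  ≡⟨ +-suc (count x u) (count x r) ⟨
  count x u + suc (count x r)  ≡⟨ cong (count x u +_) (count-here x r) ⟨
  count x u + count x (x ∷ r)  ≡⟨ count-++ x u (x ∷ r) ⟨
  count x (u ++ x ∷ r)         ≤⟨ once ⟩
  1                            ∎))
  where open ≤-Reasoning

count-↭ : ∀ x {s t} → s ↭ t → count x s ≡ count x t
count-↭ x ↭.refl = refl
count-↭ x (↭.prep {s} {t} y p) = begin
  count x (y ∷ s)           ≡⟨ count-∷ x y s ⟩
  count x [ y ] + count x s ≡⟨ cong (count x [ y ] +_) (count-↭ x p) ⟩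
  count x [ y ] + count x t ≡⟨ count-∷ x y t ⟨
  count x (y ∷ t)           ∎
  where open ≡-Reasoning
count-↭ x (↭.swap {s} {t} y z p) = begin
  count x (y ∷ z ∷ s)           ≡⟨ count-∷ x y (z ∷ s) ⟩
  cy + count x (z ∷ s)          ≡⟨ cong (cy +_) (count-∷ x z s) ⟩
  cy + (cz + count x s)         ≡⟨ +-assoc cy cz _ ⟨
  cy + cz + count x s           ≡⟨ cong₂ _+_ (+-comm cy cz) (count-↭ x p) ⟩
  cz + cy + count x t           ≡⟨ +-assoc cz cy _ ⟩
  cz + (cy + count x t)         ≡⟨ cong (cz +_) (count-∷ x y t) ⟨
  cz + count x (y ∷ t)          ≡⟨ count-∷ x z (y ∷ t) ⟨
  count x (z ∷ y ∷ t)           ∎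
  where
  open ≡-Reasoning
  cy cz : ℕ
  cy = count x [ y ]
  cz = count x [ z ]
count-↭ x (↭.trans p q) = trans (count-↭ x p) (count-↭ x q)

count-∷-cancel : ∀ x y {s t} → count x (y ∷ s) ≡ count x (y ∷ t) → count x s ≡ count x t
count-∷-cancel x y {s} {t} eq =
  +-cancelˡ-≡ (count x [ y ]) _ _ (trans (sym (count-∷ x y s)) (trans eq (count-∷ x y t)))

count≢0⇒split : ∀ x t → count x t ≢ 0 → ∃₂ λ t₁ t₂ → t ≡ t₁ ++ x ∷ t₂
count≢0⇒split x [] c≢0 = contradiction refl c≢0
count≢0⇒split x (y ∷ t) c≢0 with x ≟ y
... | yes refl = [] , t , refl
... | no _ with count≢0⇒split x t c≢0
...   | t₁ , t₂ , refl = y ∷ t₁ , t₂ , refl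

counts⇒↭ : ∀ s t → (∀ x → count x s ≡ count x t) → s ↭ t
counts⇒↭ [] [] _ = ↭.refl
counts⇒↭ [] (y ∷ t) c = contradiction (trans (c y) (count-here y t)) (λ ())
counts⇒↭ (x ∷ s) t c
  with count≢0⇒split x t (λ c≡0 → 1+n≢0 (trans (sym (count-here x s)) (trans (c x) c≡0)))
... | t₁ , t₂ , refl = begin
  x ∷ s         ↭⟨ ↭.prep x (counts⇒↭ s (t₁ ++ t₂) counts-tail) ⟩
  x ∷ t₁ ++ t₂  ↭⟨ ↭-sym (shift x t₁ t₂) ⟩
  t₁ ++ x ∷ t₂  ∎
  where
  open PermutationReasoning
  counts-tail : ∀ y → count y s ≡ count y (t₁ ++ t₂)
  counts-tail y = count-∷-cancel y x (trans (c y) (count-↭ y (shift x t₁ t₂)))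

count-mono-⊆ : ∀ x {xs ys} → xs ⊆ ys → count x xs ≤ count x ys
count-mono-⊆ x [] = z≤n
count-mono-⊆ x (_∷ʳ_ {xs} {ys} y τ) = begin
  count x xs       ≤⟨ count-mono-⊆ x τ ⟩
  count x ys       ≤⟨ m≤n+m _ (count x [ y ]) ⟩
  count x [ y ] + count x ys ≡⟨ count-∷ x y ys ⟨
  count x (y ∷ ys) ∎
  where open ≤-Reasoning
count-mono-⊆ x (_∷_ {x = y} refl τ) with x ≟ y
... | yes _ = s≤s (count-mono-⊆ x τ)
... | no _ = count-mono-⊆ x τ

replicate-⊆ : ∀ x c l → c ≤ count x l → replicate c x ⊆ l
replicate-⊆ x zero l _ = minimum l
replicate-⊆ x (suc c) (y ∷ l) c<count with x ≟ y
... | yes refl = refl ∷ replicate-⊆ x c l (≤-pred c<count)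
... | no _ = y ∷ʳ replicate-⊆ x (suc c) l c<count

⊆-++⁻ : ∀ {a} {A : Set a} {xs : List A} ys zs → xs ⊆ ys ++ zs →
        ∃₂ λ xs₁ xs₂ → xs ≡ xs₁ ++ xs₂ × xs₁ ⊆ ys × xs₂ ⊆ zs
⊆-++⁻ [] zs τ = [] , _ , refl , [] , τ
⊆-++⁻ (y ∷ ys) zs (.y ∷ʳ τ) with ⊆-++⁻ ys zs τ
... | xs₁ , xs₂ , refl , τ₁ , τ₂ = xs₁ , xs₂ , refl , y ∷ʳ τ₁ , τ₂
⊆-++⁻ (y ∷ ys) zs (refl ∷ τ) with ⊆-++⁻ ys zs τ
... | xs₁ , xs₂ , refl , τ₁ , τ₂ = y ∷ xs₁ , xs₂ , refl , refl ∷ τ₁ , τ₂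

twice-⊆⇒2≤count : ∀ x l {ys} → x ∷ x ∷ l ⊆ ys → 2 ≤ count x ys
twice-⊆⇒2≤count x l {ys} τ = begin
  2                        ≤⟨ s≤s (s≤s z≤n) ⟩
  suc (suc (count x l))    ≡⟨ cong suc (count-here x l) ⟨
  suc (count x (x ∷ l))    ≡⟨ count-here x (x ∷ l) ⟨
  count x (x ∷ x ∷ l)      ≤⟨ count-mono-⊆ x τ ⟩
  count x ys               ∎
  where open ≤-Reasoning

counts⇒Contains1122 : ∀ a b u r → a ≢ b → 1 ≤ count a u → 2 ≤ count b r → Contains1122 (u ++ a ∷ r)
counts⇒Contains1122 a b u r a≢b a∈u b∈r-twice =
  a , b , a≢b , ⊆-++⁺ (replicate-⊆ a 1 u a∈u) (refl ∷ replicate-⊆ b 2 r b∈r-twice)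

once-each⇒avoids1122 : ∀ p q → (∀ x → count x p ≤ 1) → (∀ x → count x q ≤ 1) → ¬ Contains1122 (p ++ q)
once-each⇒avoids1122 p q p-once q-once (a , b , _ , aabb⊆) with ⊆-++⁻ p q aabb⊆
... | [] , _ , refl , _ , aabb⊆q = <⇒≱ (twice-⊆⇒2≤count b [] (∷ˡ⁻ (∷ˡ⁻ aabb⊆q))) (q-once b)
... | _ ∷ [] , _ , refl , _ , abb⊆q = <⇒≱ (twice-⊆⇒2≤count b [] (∷ˡ⁻ abb⊆q)) (q-once b)
... | _ ∷ _ ∷ xs₁ , _ , eq , aa⊆p , _ with ∷-injective eq
...   | refl , eq′ with ∷-injective eq′
...     | refl , _ = <⇒≱ (twice-⊆⇒2≤count a xs₁ aa⊆p) (p-once a)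

firstIndex-here : ∀ x s → firstIndex x (x ∷ s) ≡ 0
firstIndex-here x s with x ≟ x
... | yes _ = refl
... | no x≢x = contradiction refl x≢x

firstIndex-there : ∀ {x y} s → x ≢ y → firstIndex x (y ∷ s) ≡ suc (firstIndex x s)
firstIndex-there {x} {y} s x≢y with x ≟ y
... | yes x≡y = contradiction x≡y x≢y
... | no _ = refl

firstIndex-++-absent : ∀ x u r → count x u ≡ 0 → firstIndex x (u ++ r) ≡ length u + firstIndex x r
firstIndex-++-absent x [] r _ = refl
firstIndex-++-absent x (y ∷ u) r c≡0 with x ≟ y
... | yes _ = contradiction c≡0 λ ()
... | no _ = cong suc (firstIndex-++-absent x u r c≡0)

firstIndex-++-present : ∀ x u r → count x u ≢ 0 → firstIndex x (u ++ r) ≡ firstIndex x u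
firstIndex-++-present x [] r c≢0 = contradiction refl c≢0
firstIndex-++-present x (y ∷ u) r c≢0 with x ≟ y
... | yes _ = refl
... | no _ = cong suc (firstIndex-++-present x u r c≢0)

firstIndex-≤-position : ∀ x u r → firstIndex x (u ++ x ∷ r) ≤ length u
firstIndex-≤-position x [] r = ≤-reflexive (firstIndex-here x r)
firstIndex-≤-position x (y ∷ u) r with x ≟ y
... | yes _ = z≤n
... | no _ = s≤s (firstIndex-≤-position x u r)

IsBL-range : ∀ {n} w {x} → IsBL n w → count x w ≢ 0 → 1 ≤ x × x ≤ n
IsBL-range w {x} (_ , in-range , _) c≢0 with in-range x
... | inj₁ c≡0 = contradiction c≡0 c≢0
... | inj₂ 1≤x≤n = 1≤x≤n

firstIndex-mono : ∀ {n} w → IsBL n w → ∀ {i j} → 1 ≤ i → i < j → j ≤ n →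
                  firstIndex i w < firstIndex j w
firstIndex-mono w w∈BL@(_ , _ , step) {i} {suc j} 1≤i (s≤s i≤j) j<n with m≤n⇒m<n∨m≡n i≤j
... | inj₂ refl = step i 1≤i j<n
... | inj₁ i<j =
  <-trans (firstIndex-mono w w∈BL 1≤i i<j (<⇒≤ j<n)) (step j (≤-trans 1≤i (<⇒≤ i<j)) j<n)

larger-before-first⇒¬IsBL : ∀ {n} u a b v → a < b → count a u ≡ 0 → ¬ IsBL n (u ++ b ∷ a ∷ v)
larger-before-first⇒¬IsBL {n} u a b v a<b a∉u w∈BL =
  <⇒≱ (firstIndex-mono (u ++ b ∷ a ∷ v) w∈BL 1≤a a<b b≤n) (begin
    firstIndex b (u ++ b ∷ a ∷ v)       ≤⟨ firstIndex-≤-position b u (a ∷ v) ⟩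
    length u                            ≤⟨ m≤m+n (length u) 1 ⟩
    length u + 1                        ≡⟨ cong (length u +_) a-second ⟨
    length u + firstIndex a (b ∷ a ∷ v) ≡⟨ firstIndex-++-absent a u (b ∷ a ∷ v) a∉u ⟨
    firstIndex a (u ++ b ∷ a ∷ v)       ∎)
  where
  open ≤-Reasoning
  a-second : firstIndex a (b ∷ a ∷ v) ≡ 1
  a-second = trans (firstIndex-there (a ∷ v) (<⇒≢ a<b)) (cong suc (firstIndex-here a v))
  1≤a : 1 ≤ a
  1≤a = proj₁ (IsBL-range (u ++ b ∷ a ∷ v) w∈BL a-occurs)
    where
    a-occurs : count a (u ++ b ∷ a ∷ v) ≢ 0
    a-occurs = subst (λ w → count a w ≢ 0) (++-assoc u [ b ] (a ∷ v)) (count-middle≢0 a (u ++ [ b ]) v)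
  b≤n : b ≤ n
  b≤n = proj₂ (IsBL-range (u ++ b ∷ a ∷ v) w∈BL (count-middle≢0 b u (a ∷ v)))

ascending-suc : ∀ n → ascending (suc n) ≡ ascending n ++ [ suc n ]
ascending-suc n = sym (applyUpTo-∷ʳ suc n)

count-ascending-out : ∀ n x → ¬ (1 ≤ x × x ≤ n) → count x (ascending n) ≡ 0
count-ascending-out zero x _ = refl
count-ascending-out (suc n) x out = begin
  count x (ascending (suc n))                ≡⟨ cong (count x) (ascending-suc n) ⟩
  count x (ascending n ++ [ suc n ])         ≡⟨ count-++ x (ascending n) [ suc n ] ⟩
  count x (ascending n) + count x [ suc n ]  ≡⟨ cong₂ _+_ (count-ascending-out n x out′) (count-there [] x≢1+n) ⟩
  0                                          ∎
  where
  open ≡-Reasoning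
  out′ : ¬ (1 ≤ x × x ≤ n)
  out′ (1≤x , x≤n) = out (1≤x , m≤n⇒m≤1+n x≤n)
  x≢1+n : x ≢ suc n
  x≢1+n refl = out (s≤s z≤n , ≤-refl)

count-ascending-in : ∀ n x → 1 ≤ x → x ≤ n → count x (ascending n) ≡ 1
count-ascending-in zero (suc x) _ ()
count-ascending-in (suc n) x 1≤x x≤1+n = begin
  count x (ascending (suc n))                ≡⟨ cong (count x) (ascending-suc n) ⟩
  count x (ascending n ++ [ suc n ])         ≡⟨ count-++ x (ascending n) [ suc n ] ⟩
  count x (ascending n) + count x [ suc n ]  ≡⟨ last-or-earlier (m≤n⇒m<n∨m≡n x≤1+n) ⟩
  1                                          ∎
  where
  open ≡-Reasoning
  last-or-earlier : x < suc n ⊎ x ≡ suc n → count x (ascending n) + count x [ suc n ] ≡ 1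
  last-or-earlier (inj₁ (s≤s x≤n)) =
    cong₂ _+_ (count-ascending-in n x 1≤x x≤n) (count-there [] (<⇒≢ (s≤s x≤n)))
  last-or-earlier (inj₂ refl) =
    cong₂ _+_ (count-ascending-out n x (λ (_ , x≤n) → 1+n≰n x≤n)) (count-here x [])

count-ascending-≤1 : ∀ n x → count x (ascending n) ≤ 1
count-ascending-≤1 n x with (1 ≤? x) ×-dec (x ≤? n)
... | yes (1≤x , x≤n) = ≤-reflexive (count-ascending-in n x 1≤x x≤n)
... | no out = subst (_≤ 1) (sym (count-ascending-out n x out)) z≤n

count-ascending-≢0 : ∀ n {i} → i < n → count (suc i) (ascending n) ≢ 0
count-ascending-≢0 n {i} i<n c≡0 = 1+n≢0 (trans (sym (count-ascending-in n (suc i) (s≤s z≤n) i<n)) c≡0)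

firstIndex-ascending : ∀ n {i} → i < n → firstIndex (suc i) (ascending n) ≡ i
firstIndex-ascending (suc n) {i} i<1+n = begin
  firstIndex (suc i) (ascending (suc n))         ≡⟨ cong (firstIndex (suc i)) (ascending-suc n) ⟩
  firstIndex (suc i) (ascending n ++ [ suc n ])  ≡⟨ last-or-earlier (m≤n⇒m<n∨m≡n (≤-pred i<1+n)) ⟩
  i                                              ∎
  where
  open ≡-Reasoning
  last-or-earlier : i < n ⊎ i ≡ n → firstIndex (suc i) (ascending n ++ [ suc n ]) ≡ i
  last-or-earlier (inj₁ i<n) =
    trans (firstIndex-++-present (suc i) (ascending n) [ suc n ] (count-ascending-≢0 n i<n))
          (firstIndex-ascending n i<n)
  last-or-earlier (inj₂ refl) = begin
    firstIndex (suc i) (ascending i ++ [ suc i ])        ≡⟨ firstIndex-++-absent (suc i) (ascending i) _ absent ⟩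
    length (ascending i) + firstIndex (suc i) [ suc i ]  ≡⟨ cong₂ _+_ (length-applyUpTo suc i) (firstIndex-here (suc i) []) ⟩
    i + 0                                                ≡⟨ +-identityʳ i ⟩
    i                                                    ∎
    where
    absent : count (suc i) (ascending i) ≡ 0
    absent = count-ascending-out i (suc i) (λ (_ , i<i) → 1+n≰n i<i)

↭ascending⇒IsBL : ∀ n τ → τ ↭ ascending n → IsBL n (ascending n ++ τ)
↭ascending⇒IsBL n τ τ↭R = twice , in-range , first-occurrences-ordered
  where
  R : Word
  R = ascending n
  doubled : ∀ x → count x (R ++ τ) ≡ count x R + count x R
  doubled x = trans (count-++ x R τ) (cong (count x R +_) (count-↭ x τ↭R))
  twice : ∀ x → 1 ≤ x → x ≤ n → count x (R ++ τ) ≡ 2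
  twice x 1≤x x≤n = trans (doubled x) (cong₂ _+_ once once)
    where
    once : count x R ≡ 1
    once = count-ascending-in n x 1≤x x≤n
  in-range : ∀ x → count x (R ++ τ) ≡ 0 ⊎ (1 ≤ x × x ≤ n)
  in-range x with (1 ≤? x) ×-dec (x ≤? n)
  ... | yes 1≤x≤n = inj₂ 1≤x≤n
  ... | no out = inj₁ (trans (doubled x) (cong₂ _+_ never never))
    where
    never : count x R ≡ 0
    never = count-ascending-out n x out
  firstIndex-R : ∀ {i} → i < n → firstIndex (suc i) (R ++ τ) ≡ i
  firstIndex-R {i} i<n =
    trans (firstIndex-++-present (suc i) R τ (count-ascending-≢0 n i<n)) (firstIndex-ascending n i<n)
  first-occurrences-ordered : ∀ i → 1 ≤ i → suc i ≤ n → firstIndex i (R ++ τ) < firstIndex (suc i) (R ++ τ)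
  first-occurrences-ordered (suc i) _ 2+i≤n =
    subst₂ _<_ (sym (firstIndex-R (<-trans (n<1+n i) 2+i≤n))) (sym (firstIndex-R 2+i≤n)) (n<1+n i)

IsBL⇒↭ascending : ∀ n τ → IsBL n (ascending n ++ τ) → τ ↭ ascending n
IsBL⇒↭ascending n τ (twice , in-range , _) =
  counts⇒↭ τ R (λ x → +-cancelˡ-≡ (count x R) _ _ (trans (sym (count-++ x R τ)) (doubled x)))
  where
  R : Word
  R = ascending n
  doubled : ∀ x → count x (R ++ τ) ≡ count x R + count x R
  doubled x with (1 ≤? x) ×-dec (x ≤? n)
  ... | yes (1≤x , x≤n) = trans (twice x 1≤x x≤n) (sym (cong₂ _+_ once once))
    where
    once : count x R ≡ 1
    once = count-ascending-in n x 1≤x x≤n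
  ... | no out with in-range x
  ...   | inj₁ c≡0 = trans c≡0 (sym (cong₂ _+_ never never))
    where
    never : count x R ≡ 0
    never = count-ascending-out n x out
  ...   | inj₂ 1≤x≤n = contradiction 1≤x≤n out

data AdjacentSwap {a ℓ} {A : Set a} (R : Rel A ℓ) : Rel (List A) (a ⊔ ℓ) where
  here  : ∀ {x y} zs → R x y → AdjacentSwap R (x ∷ y ∷ zs) (y ∷ x ∷ zs)
  there : ∀ z {xs ys} → AdjacentSwap R xs ys → AdjacentSwap R (z ∷ xs) (z ∷ ys)

module _ {a ℓ} {A : Set a} {R : Rel A ℓ} where

  AdjacentSwap-map : ∀ {s} {S : Rel A s} → R ⇒ S → AdjacentSwap R ⇒ AdjacentSwap S
  AdjacentSwap-map R⇒S (here zs r) = here zs (R⇒S r)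
  AdjacentSwap-map R⇒S (there z σ) = there z (AdjacentSwap-map R⇒S σ)

  AdjacentSwap-flip : ∀ {xs ys} → AdjacentSwap (flip R) xs ys → AdjacentSwap R ys xs
  AdjacentSwap-flip (here zs r) = here zs r
  AdjacentSwap-flip (there z σ) = there z (AdjacentSwap-flip σ)

  AdjacentSwap⇒↭ : ∀ {xs ys} → AdjacentSwap R xs ys → xs ↭ ys
  AdjacentSwap⇒↭ (here {x} {y} zs _) = ↭.swap x y ↭.refl
  AdjacentSwap⇒↭ (there z σ) = ↭.prep z (AdjacentSwap⇒↭ σ)

module _ {a ℓ₁ ℓ₂} (O : DecTotalOrder a ℓ₁ ℓ₂) where
  open DecTotalOrder O using () renaming (_≤_ to _⊑_; _≤?_ to _⊑?_)
  open InsertionSort O using (insert; sort)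

  insert-swaps : ∀ x xs → Star (AdjacentSwap λ u v → ¬ v ⊑ u) (insert x xs) (x ∷ xs)
  insert-swaps x [] = ε
  insert-swaps x (y ∷ xs) with x ⊑? y
  ... | yes _ = ε
  ... | no x⋢y = gmap (y ∷_) (there y) (insert-swaps x xs) ◅◅ here xs x⋢y ◅ ε

  sort-swaps : ∀ xs → Star (AdjacentSwap λ u v → ¬ v ⊑ u) (sort xs) xs
  sort-swaps [] = ε
  sort-swaps (x ∷ xs) = insert-swaps x (sort xs) ◅◅ gmap (x ∷_) (there x) (sort-swaps xs)

ascending-↗ : ∀ n → Sorted ≤-totalOrder (ascending n)
ascending-↗ n = applyUpTo⁺₂ ≤-totalOrder suc n (λ i → n≤1+n (suc i))

reverse-ascending-↘ : ∀ n → Sorted ≥-totalOrder (reverse (ascending n))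
reverse-ascending-↘ n =
  subst (Sorted ≥-totalOrder) (sym (reverse-applyUpTo suc n))
        (applyDownFrom⁺₂ ≥-totalOrder suc n (λ i → n≤1+n (suc i)))

swaps-from-ascending : ∀ n {τ} → τ ↭ ascending n → Star (AdjacentSwap _<_) (ascending n) τ
swaps-from-ascending n {τ} τ↭R = subst (λ s → Star (AdjacentSwap _<_) s τ) sort≡ascending
  (gmap id (AdjacentSwap-map ≰⇒>) (sort-swaps ≤-decTotalOrder τ))
  where
  open InsertionSort ≤-decTotalOrder using (sort)
  open InsertionSortₚ ≤-decTotalOrder using (sort-↗; sort-↭)
  sort≡ascending : sort τ ≡ ascending n
  sort≡ascending = ≋⇒≡ (↗↭↗⇒≋ ≤-totalOrder (sort-↗ τ) (ascending-↗ n) (↭⇒↭ₛ (↭.trans (sort-↭ τ) τ↭R)))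

swaps-to-descending : ∀ n {τ} → τ ↭ ascending n → Star (AdjacentSwap _<_) τ (reverse (ascending n))
swaps-to-descending n {τ} τ↭R = subst (Star (AdjacentSwap _<_) τ) sort≡reverse
  (Star.reverse (AdjacentSwap-flip ∘ AdjacentSwap-map ≰⇒>) (sort-swaps ≥-decTotalOrder τ))
  where
  open InsertionSort ≥-decTotalOrder using (sort)
  open InsertionSortₚ ≥-decTotalOrder using (sort-↗; sort-↭)
  sort↭reverse : sort τ ↭ reverse (ascending n)
  sort↭reverse = ↭.trans (sort-↭ τ) (↭.trans τ↭R (↭-sym (↭-reverse (ascending n))))
  sort≡reverse : sort τ ≡ reverse (ascending n)
  sort≡reverse = ≋⇒≡ (↗↭↗⇒≋ ≥-totalOrder (sort-↗ τ) (reverse-ascending-↘ n) (↭⇒↭ₛ sort↭reverse))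

AdjacentSwap⇒Cover : ∀ {n} p {s t} → AdjacentSwap _<_ s t →
                     IsBL n (p ++ s) → IsBL n (p ++ t) → Cover n (p ++ s) (p ++ t)
AdjacentSwap⇒Cover p (here {a} {b} v a<b) = swap p v a b a<b
AdjacentSwap⇒Cover {n} p (there z {s} {t} σ) s∈BL t∈BL =
  subst₂ (Cover n) (++-assoc p [ z ] s) (++-assoc p [ z ] t)
    (AdjacentSwap⇒Cover (p ++ [ z ]) σ (regroup s s∈BL) (regroup t t∈BL))
  where
  regroup : ∀ r → IsBL n (p ++ z ∷ r) → IsBL n ((p ++ [ z ]) ++ r)
  regroup r = subst (IsBL n) (sym (++-assoc p [ z ] r))

swaps⇒≤BL : ∀ n {s t} → Star (AdjacentSwap _<_) s t → s ↭ ascending n →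
            (ascending n ++ s) ≤BL[ n ] (ascending n ++ t)
swaps⇒≤BL n ε _ = ε
swaps⇒≤BL n {s} (_◅_ {j = s′} σ σs) s↭R =
  AdjacentSwap⇒Cover (ascending n) σ (↭ascending⇒IsBL n s s↭R) (↭ascending⇒IsBL n s′ s′↭R)
    ◅ swaps⇒≤BL n σs s′↭R
  where
  s′↭R : s′ ↭ ascending n
  s′↭R = ↭.trans (↭-sym (AdjacentSwap⇒↭ σ)) s↭R

smaller-next⇒Contains1122 : ∀ {n} k x r → IsBL n (ascending k ++ x ∷ r) → x < suc k → k < n →
                            Contains1122 (ascending k ++ x ∷ r)
smaller-next⇒Contains1122 {n} k x r w∈BL@(twice , _) x<1+k k<n =
  counts⇒Contains1122 x n (ascending k) r x≢n x∈R n∈r-twice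
  where
  1≤x : 1 ≤ x
  1≤x = proj₁ (IsBL-range (ascending k ++ x ∷ r) w∈BL (count-middle≢0 x (ascending k) r))
  x≢n : x ≢ n
  x≢n = <⇒≢ (<-≤-trans x<1+k k<n)
  x∈R : 1 ≤ count x (ascending k)
  x∈R = ≤-reflexive (sym (count-ascending-in k x 1≤x (≤-pred x<1+k)))
  n∈r-twice : 2 ≤ count n r
  n∈r-twice = ≤-reflexive (begin
    2                                        ≡⟨ twice n (≤-trans (s≤s z≤n) k<n) ≤-refl ⟨
    count n (ascending k ++ x ∷ r)           ≡⟨ count-++ n (ascending k) (x ∷ r) ⟩
    count n (ascending k) + count n (x ∷ r)  ≡⟨ cong₂ _+_ n∉R (count-there r (x≢n ∘ sym)) ⟩
    count n r                                ∎)
    where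
    open ≡-Reasoning
    n∉R : count n (ascending k) ≡ 0
    n∉R = count-ascending-out k n (λ (_ , n≤k) → <⇒≱ k<n n≤k)

larger-next⇒¬IsBL : ∀ {n} k x r → suc k < x → ¬ IsBL n (ascending k ++ x ∷ r)
larger-next⇒¬IsBL {n} k x r 1+k<x w∈BL =
  <-asym (firstIndex-mono w w∈BL (s≤s z≤n) 1+k<x x≤n) (begin-strict
  firstIndex x w                                  ≡⟨ firstIndex-++-absent x R (x ∷ r) (absent x (<⇒≤ 1+k<x)) ⟩
  length R + firstIndex x (x ∷ r)                 ≡⟨ cong (length R +_) (firstIndex-here x r) ⟩
  length R + 0                                    <⟨ +-monoʳ-< (length R) (s≤s z≤n) ⟩
  length R + suc (firstIndex (suc k) r)           ≡⟨ cong (length R +_) (firstIndex-there r (<⇒≢ 1+k<x)) ⟨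
  length R + firstIndex (suc k) (x ∷ r)           ≡⟨ firstIndex-++-absent (suc k) R (x ∷ r) (absent (suc k) ≤-refl) ⟨
  firstIndex (suc k) w                            ∎)
  where
  open ≤-Reasoning
  R w : Word
  R = ascending k
  w = R ++ x ∷ r
  x≤n : x ≤ n
  x≤n = proj₂ (IsBL-range w w∈BL (count-middle≢0 x R r))
  absent : ∀ y → suc k ≤ y → count y R ≡ 0
  absent y k<y = count-ascending-out k y (λ (_ , y≤k) → <⇒≱ k<y y≤k)

ascending-prefix-extend : ∀ {n} k r → IsBL n (ascending k ++ r) → ¬ Contains1122 (ascending k ++ r) → k < n →
                          ∃ λ r′ → ascending k ++ r ≡ ascending (suc k) ++ r′
ascending-prefix-extend k [] (twice , _) _ k<n = contradiction (begin
  0                                  ≡⟨ count-ascending-out k (suc k) (λ (_ , k+1≤k) → 1+n≰n k+1≤k) ⟨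
  count (suc k) (ascending k)        ≡⟨ cong (count (suc k)) (++-identityʳ (ascending k)) ⟨
  count (suc k) (ascending k ++ [])  ≡⟨ twice (suc k) (s≤s z≤n) k<n ⟩
  2                                  ∎) λ ()
  where open ≡-Reasoning
ascending-prefix-extend k (x ∷ r) w∈BL avoids k<n with <-cmp x (suc k)
... | tri< x<1+k _ _ = contradiction (smaller-next⇒Contains1122 k x r w∈BL x<1+k k<n) avoids
... | tri> _ _ 1+k<x = contradiction w∈BL (larger-next⇒¬IsBL k x r 1+k<x)
... | tri≈ _ refl _ = r , (begin
  ascending k ++ suc k ∷ r          ≡⟨ ++-assoc (ascending k) [ suc k ] r ⟨
  (ascending k ++ [ suc k ]) ++ r   ≡⟨ cong (_++ r) (ascending-suc k) ⟨
  ascending (suc k) ++ r            ∎)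
  where open ≡-Reasoning

avoids1122⇒ascending-prefix : ∀ n w → IsBL n w → ¬ Contains1122 w → ∃ λ τ → w ≡ ascending n ++ τ
avoids1122⇒ascending-prefix n w w∈BL avoids = prefix n ≤-refl
  where
  prefix : ∀ k → k ≤ n → ∃ λ r → w ≡ ascending k ++ r
  prefix zero _ = w , refl
  prefix (suc k) k<n with prefix k (<⇒≤ k<n)
  ... | r , refl = ascending-prefix-extend k r w∈BL avoids k<n

++-∷-split : ∀ {a} {A : Set a} (p u : List A) x w q → u ++ x ∷ w ≡ p ++ q →
             (∃ λ u′ → u ≡ p ++ u′) ⊎ (∃ λ r → p ≡ u ++ x ∷ r)
++-∷-split [] u x w q eq = inj₁ (u , refl)
++-∷-split (y ∷ p) [] x w q eq with ∷-injective eq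
... | refl , _ = inj₂ (p , refl)
++-∷-split (y ∷ p) (z ∷ u) x w q eq with ∷-injective eq
... | refl , eq′ with ++-∷-split p u x w q eq′
...   | inj₁ (u′ , refl) = inj₁ (u′ , refl)
...   | inj₂ (r , refl) = inj₂ (r , refl)

Cover-preserves-prefix : ∀ {n} p → (∀ x → count x p ≤ 1) → ∀ {s t} → Cover n s t →
                         ∃ (λ τ → s ≡ p ++ τ) → ∃ λ τ → t ≡ p ++ τ
Cover-preserves-prefix p once (swap u v a b a<b _ t∈BL) (τ , eq) with ++-∷-split p u a (b ∷ v) τ eq
... | inj₁ (u′ , refl) = u′ ++ b ∷ a ∷ v , ++-assoc p u′ (b ∷ a ∷ v)
... | inj₂ (r , refl) =
  contradiction t∈BL (larger-before-first⇒¬IsBL u a b v a<b (count≤1⇒count-prefix≡0 a u r (once a)))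

≤BL-preserves-prefix : ∀ {n} p → (∀ x → count x p ≤ 1) → ∀ {s t} → s ≤BL[ n ] t →
                       ∃ (λ τ → s ≡ p ++ τ) → ∃ λ τ → t ≡ p ++ τ
≤BL-preserves-prefix p once ε = id
≤BL-preserves-prefix p once (c ◅ cs) = ≤BL-preserves-prefix p once cs ∘ Cover-preserves-prefix p once c

proposition6p1 : (n : ℕ) → 1 ≤ n → (w : Word) → IsBL n w →
    ((¬ Contains1122 w) ⇔ (bottomBL n ≤BL[ n ] w × w ≤BL[ n ] topBL n))
-- The case n = 0 needs no separate treatment, so 1 ≤ n is not used.
proposition6p1 n _ w w∈BL = mk⇔ between-bounds avoids1122
  where
  R : Word
  R = ascending n

  between-bounds : ¬ Contains1122 w → bottomBL n ≤BL[ n ] w × w ≤BL[ n ] topBL n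
  between-bounds avoids with avoids1122⇒ascending-prefix n w w∈BL avoids
  ... | τ , refl = swaps⇒≤BL n (swaps-from-ascending n τ↭R) ↭.refl
                 , swaps⇒≤BL n (swaps-to-descending n τ↭R) τ↭R
    where
    τ↭R : τ ↭ R
    τ↭R = IsBL⇒↭ascending n τ w∈BL

  avoids1122 : bottomBL n ≤BL[ n ] w × w ≤BL[ n ] topBL n → ¬ Contains1122 w
  avoids1122 (bottom≤w , _) with ≤BL-preserves-prefix R (count-ascending-≤1 n) bottom≤w (R , refl)
  ... | τ , refl = once-each⇒avoids1122 R τ (count-ascending-≤1 n) τ-once
    where
    τ-once : ∀ x → count x τ ≤ 1
    τ-once x = subst (_≤ 1) (sym (count-↭ x (IsBL⇒↭ascending n τ w∈BL))) (count-ascending-≤1 n x)
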